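{- Let $N\in\mathbb{N}$ and $X\in\mathbb{Z}^{\mathcal{D}_N}$. If $\eta^X$ is a holomorphic eta quotient which is not factorizable on $\Gamma_0(N)$, then either $X\in B_N\cdot[0,1)^{\mathcal{D}_N}$ (i.e. $X=B_Ny$ for some $y\in[0,1)^{\mathcal{D}_N}$) or $X=B_N(\cdot,t)$ for some $t\in\mathcal{D}_N$.
   Context: Let $\eta(z)=q^{1/24}\prod_{n\ge1}(1-q^n)$, $q=e^{2\pi i z}$, $z$ in the upper half plane, $\eta_d(z)=\eta(dz)$. Let $\mathcal{D}_N$ be the set of positive divisors of $N$ and $\eta^X=\prod_{d\in\mathcal{D}_N}\eta_d^{X_d}$ for $X\in\mathbb{Z}^{\mathcal{D}_N}$. Let $A_N(t,d)=\frac{N\gcd(d,t)^2}{d\gcd(t^2,N)}$ for $t,d\in\mathcal{D}_N$ (invertible over $\mathbb{Q}$); $\eta^X$ is holomorphic iff $A_NX\ge0$ componentwise. A holomorphic eta quotient $f$ is factorizable on $\Gamma_0(N)$ if $f=gh$ with $g,h$ nonconstant holomorphic eta quotients whose levels divide $N$ (the level of $\prod_d\eta_d^{X_d}$ being $\operatorname{lcm}\{d:X_d\ne0\}$). For $t\in\mathcal{D}_N$ let $m_{t,N}$ be the smallest positive integer with $m_{t,N}A_N^{ -1}(\cdot,t)\in\mathbb{Z}^{\mathcal{D}_N}$ ($A_N^{ -1}(\cdot,t)$ the column indexed by $t$), and let $B_N(\cdot,t)=m_{t,N}A_N^{ -1}(\cdot,t)$. -}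

module Defs where

open import Data.Nat as ℕ using (ℕ; zero; suc; _^_; NonZero)
open import Data.Nat.Divisibility using (_∣_; _∣?_)
open import Data.Nat.GCD using (gcd)
open import Data.Integer as ℤ using (ℤ; +_)
open import Data.Rational as ℚ using (ℚ; 0ℚ; 1ℚ; _/_; _≤_; _<_)
open import Data.List using (List; upTo; filter; foldr; map)
open import Data.List.Membership.Propositional using (_∈_)
open import Data.Product using (Σ; ∃; _×_; _,_)
open import Relation.Binary.PropositionalEquality using (_≡_; _≢_)
open import Relation.Nullary using (¬_; yes; no)

-- Vectors in ℤ^{D_N} (resp. ℚ^{D_N}) are represented as functions ℕ → ℤ
-- (resp. ℕ → ℚ); only their values on the divisors of N are ever used.

divisors : ℕ → List ℕ
divisors N = filter (_∣? N) (upTo (suc N))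

-- p / n as a rational (junk value 0 when n = 0; never used since n ≥ 1).
frac : ℤ → ℕ → ℚ
frac p zero    = 0ℚ
frac p (suc n) = p / suc n

ι : ℤ → ℚ
ι z = z / 1

Σ𝒟 : ℕ → (ℕ → ℚ) → ℚ
Σ𝒟 N f = foldr ℚ._+_ 0ℚ (map f (divisors N))

A : ℕ → ℕ → ℕ → ℚ
A N t d = frac (+ (N ℕ.* (gcd d t ^ 2))) (d ℕ.* gcd (t ^ 2) N)

AX : ℕ → (ℕ → ℤ) → ℕ → ℚ
AX N X t = Σ𝒟 N (λ d → A N t d ℚ.* ι (X d))

-- η^X is holomorphic iff A_N X ≥ 0 componentwise
Holomorphic : ℕ → (ℕ → ℤ) → Set
Holomorphic N X = ∀ t → t ∈ divisors N → 0ℚ ≤ AX N X t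

-- η^Y is nonconstant iff Y ≠ 0 (eta quotients determine their exponents)
NonConstant : ℕ → (ℕ → ℤ) → Set
NonConstant N Y = ∃ λ d → d ∈ divisors N × Y d ≢ + 0

-- η^X = η^Y η^Z with η^Y, η^Z nonconstant holomorphic eta quotients of
-- level dividing N, i.e. Y, Z ∈ ℤ^{D_N}, Y + Z = X.
Factorizable : ℕ → (ℕ → ℤ) → Set
Factorizable N X =
  ∃ λ Y → ∃ λ Z →
    Holomorphic N Y × Holomorphic N Z ×
    NonConstant N Y × NonConstant N Z ×
    (∀ d → d ∈ divisors N → X d ≡ Y d ℤ.+ Z d)

δ : ℕ → ℕ → ℚ
δ t d with t ℕ.≟ d
... | yes _ = 1ℚ
... | no  _ = 0ℚ

IsInverseOfA : ℕ → (ℕ → ℕ → ℚ) → Set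
IsInverseOfA N C =
  (∀ t d → t ∈ divisors N → d ∈ divisors N →
     Σ𝒟 N (λ e → A N t e ℚ.* C e d) ≡ δ t d) ×
  (∀ t d → t ∈ divisors N → d ∈ divisors N →
     Σ𝒟 N (λ e → C t e ℚ.* A N e d) ≡ δ t d)

IntegralColumnMultiple : ℕ → (ℕ → ℕ → ℚ) → ℕ → ℕ → Set
IntegralColumnMultiple N C t m =
  ∀ d → d ∈ divisors N → ∃ λ (z : ℤ) → ι (+ m) ℚ.* C d t ≡ ι z

IsMinimalMultiplier : ℕ → (ℕ → ℕ → ℚ) → ℕ → ℕ → Set
IsMinimalMultiplier N C t m =
  1 ℕ.≤ m × IntegralColumnMultiple N C t m ×
  (∀ k → 1 ℕ.≤ k → IntegralColumnMultiple N C t k → m ℕ.≤ k)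

B : (ℕ → ℕ → ℚ) → (ℕ → ℕ) → ℕ → ℕ → ℚ
B C m d t = ι (+ m t) ℚ.* C d t

{-# OPTIONS --safe #-}
module Submission where

-- Put y(t) = (A_N X)(t) / m_{t,N}.  Since B_N(·,t) = m_{t,N} A_N⁻¹(·,t), we always have
-- X = B_N y, and holomorphy says y ≥ 0.  If moreover y < 1 we are in the first case.
-- Otherwise (A_N X)(t) ≥ m_{t,N} for some t; then Z = B_N(·,t) is an integral vector with
-- A_N Z = m_{t,N} e_t, so both Z and X − Z are holomorphic and Z ≠ 0.  As X is not
-- factorizable, X − Z must vanish, i.e. X = B_N(·,t).

open import Defs
open import Data.Integer as ℤ using (ℤ; +_; -[1+_]; ∣_∣)
import Data.Integer.Properties as ℤ
open import Algebra.Properties.AbelianGroup ℤ.+-0-abelianGroup using (xyx⁻¹≈y)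
open import Data.List using (List; []; _∷_; foldr; map)
open import Data.List.Membership.Propositional using (_∈_; find)
open import Data.List.Relation.Unary.All as All using (All; []; _∷_; all?)
open import Data.List.Relation.Unary.All.Properties using (¬All⇒Any¬)
open import Data.List.Relation.Unary.AllPairs using (_∷_)
open import Data.List.Relation.Unary.Any using (here; there)
open import Data.List.Relation.Unary.Unique.Propositional using (Unique)
import Data.List.Relation.Unary.Unique.Propositional.Properties as Unique
open import Data.Nat as ℕ using (ℕ; zero; suc; NonZero)
open import Data.Nat.Coprimality as Coprime using (Coprime; 1-coprimeTo)
open import Data.Nat.Divisibility using (_∣?_)
open import Data.Product using (∃; _×_; _,_; proj₁; proj₂)
open import Data.Rational
  using (ℚ; 0ℚ; 1ℚ; _≤_; _<_; mkℚ; ↥_; _/_; _+_; _-_; _*_; -_; 1/_; nonNegative)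
open import Data.Rational.Properties
  using ( normalize-coprime; *-inverseʳ; *-comm; *-assoc; *-identityˡ; *-identityʳ
        ; *-zeroˡ; *-zeroʳ; *-distribˡ-+; +-identityˡ; +-identityʳ; +-inverseʳ; +-monoˡ-≤
        ; ≤-refl; _<?_; ≮⇒≥; nonNegative⁻¹; *-monoʳ-≤-nonNeg; nonNeg*nonNeg⇒nonNeg
        ; module ≤-Reasoning )
open import Data.Rational.Solver using (module +-*-Solver)
open import Data.Sum using (_⊎_; inj₁; inj₂)
open import Function using (_∘_)
open import Relation.Binary.PropositionalEquality
  using (_≡_; _≢_; refl; sym; trans; cong; cong₂; subst; module ≡-Reasoning)
open import Relation.Nullary using (¬_; yes; no; contradiction)
open import Relation.Unary using (Decidable)

open +-*-Solver

coprime-to-1 : ∀ n → Coprime n 1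
coprime-to-1 n = Coprime.sym (1-coprimeTo n)

ι≡mkℚ : ∀ z → ι z ≡ mkℚ z 0 (coprime-to-1 ∣ z ∣)
ι≡mkℚ (+ n)    = normalize-coprime (coprime-to-1 n)
ι≡mkℚ -[1+ n ] = cong -_ (normalize-coprime (coprime-to-1 (suc n)))

ι-homo-+ : ∀ a b → ι (a ℤ.+ b) ≡ ι a + ι b
ι-homo-+ a b rewrite ι≡mkℚ a | ι≡mkℚ b =
  cong (_/ 1) (sym (cong₂ ℤ._+_ (ℤ.*-identityʳ a) (ℤ.*-identityʳ b)))

↥ι : ∀ z → ↥ ι z ≡ z
↥ι z = cong ↥_ (ι≡mkℚ z)

ι-↥ : ∀ {q} → ∃ (λ z → q ≡ ι z) → ι (↥ q) ≡ q
ι-↥ (z , refl) = cong ι (↥ι z)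

ι+≢0 : ∀ n → 1 ℕ.≤ n → ι (+ n) ≢ 0ℚ
ι+≢0 (suc n) _ ι≡0 with trans (sym (↥ι (+ suc n))) (cong ↥_ ι≡0)
... | ()

0≤ι+ : ∀ n → 0ℚ ≤ ι (+ n)
0≤ι+ n rewrite ι≡mkℚ (+ n) = nonNegative⁻¹ _

-- reciprocal 0 = 0 is a junk value.
reciprocal : ℕ → ℚ
reciprocal zero    = 0ℚ
reciprocal (suc n) = 1/ mkℚ (+ suc n) 0 (coprime-to-1 (suc n))

ι*reciprocal : ∀ n → 1 ℕ.≤ n → ι (+ n) * reciprocal n ≡ 1ℚ
ι*reciprocal (suc n) _ rewrite ι≡mkℚ (+ suc n) = *-inverseʳ (mkℚ (+ suc n) 0 (coprime-to-1 (suc n)))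

0≤reciprocal : ∀ n → 0ℚ ≤ reciprocal n
0≤reciprocal zero    = ≤-refl
0≤reciprocal (suc n) = nonNegative⁻¹ _

0≤p⇒0≤q⇒0≤p*q : ∀ {p q} → 0ℚ ≤ p → 0ℚ ≤ q → 0ℚ ≤ p * q
0≤p⇒0≤q⇒0≤p*q {p} {q} 0≤p 0≤q = nonNegative⁻¹ (p * q)
  {{nonNeg*nonNeg⇒nonNeg p {{nonNegative 0≤p}} q {{nonNegative 0≤q}}}}

p≤q⇒0≤q-p : ∀ {p q} → p ≤ q → 0ℚ ≤ q - p
p≤q⇒0≤q-p {p} {q} p≤q = subst (_≤ q - p) (+-inverseʳ p) (+-monoˡ-≤ (- p) p≤q)

*reciprocal≮1⇒ι≤ : ∀ p n → 1 ℕ.≤ n → ¬ (p * reciprocal n < 1ℚ) → ι (+ n) ≤ p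
*reciprocal≮1⇒ι≤ p n 1≤n p/n≮1 = begin
  ι (+ n)                        ≡⟨ *-identityˡ (ι (+ n)) ⟨
  1ℚ * ι (+ n)                   ≤⟨ *-monoʳ-≤-nonNeg (ι (+ n)) {{nonNegative (0≤ι+ n)}} (≮⇒≥ p/n≮1) ⟩
  p * reciprocal n * ι (+ n)     ≡⟨ *-assoc p (reciprocal n) (ι (+ n)) ⟩
  p * (reciprocal n * ι (+ n))   ≡⟨ cong (p *_) (trans (*-comm (reciprocal n) (ι (+ n))) (ι*reciprocal n 1≤n)) ⟩
  p * 1ℚ                         ≡⟨ *-identityʳ p ⟩
  p                              ∎
  where open ≤-Reasoning

private variable
  I J : Set

-- Chosen so that Σ𝒟 N f is definitionally ∑ (divisors N) f.
∑ : List I → (I → ℚ) → ℚ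
∑ l f = foldr _+_ 0ℚ (map f l)

∑-cong : ∀ l {f g : I → ℚ} → (∀ x → x ∈ l → f x ≡ g x) → ∑ l f ≡ ∑ l g
∑-cong []      f≗g = refl
∑-cong (x ∷ l) f≗g = cong₂ _+_ (f≗g x (here refl)) (∑-cong l (λ y y∈ → f≗g y (there y∈)))

∑-zero : ∀ (l : List I) → ∑ l (λ _ → 0ℚ) ≡ 0ℚ
∑-zero []      = refl
∑-zero (x ∷ l) = trans (+-identityˡ _) (∑-zero l)

∑-distrib-+ : ∀ l (f g : I → ℚ) → ∑ l (λ x → f x + g x) ≡ ∑ l f + ∑ l g
∑-distrib-+ []      f g = refl
∑-distrib-+ (x ∷ l) f g rewrite ∑-distrib-+ l f g =
  solve 4 (λ a b c d → (a :+ b) :+ (c :+ d) := (a :+ c) :+ (b :+ d)) refl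
    (f x) (g x) (∑ l f) (∑ l g)

∑-*ˡ : ∀ l c (f : I → ℚ) → ∑ l (λ x → c * f x) ≡ c * ∑ l f
∑-*ˡ []      c f = sym (*-zeroʳ c)
∑-*ˡ (x ∷ l) c f rewrite ∑-*ˡ l c f =
  solve 3 (λ c a b → c :* a :+ c :* b := c :* (a :+ b)) refl c (f x) (∑ l f)

∑-*ʳ : ∀ l c (f : I → ℚ) → ∑ l (λ x → f x * c) ≡ ∑ l f * c
∑-*ʳ l c f = begin
  ∑ l (λ x → f x * c)  ≡⟨ ∑-cong l (λ x _ → *-comm (f x) c) ⟩
  ∑ l (λ x → c * f x)  ≡⟨ ∑-*ˡ l c f ⟩
  c * ∑ l f            ≡⟨ *-comm c (∑ l f) ⟩
  ∑ l f * c            ∎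
  where open ≡-Reasoning

∑-comm : ∀ l (k : List J) (f : I → J → ℚ) →
         ∑ l (λ x → ∑ k (f x)) ≡ ∑ k (λ y → ∑ l (λ x → f x y))
∑-comm []      k f = sym (∑-zero k)
∑-comm (x ∷ l) k f rewrite ∑-comm l k f = sym (∑-distrib-+ k (f x) (λ y → ∑ l (λ x → f x y)))

δ-refl : ∀ x → δ x x ≡ 1ℚ
δ-refl x with x ℕ.≟ x
... | yes _  = refl
... | no x≢x = contradiction refl x≢x

δ-≢ : ∀ {x y} → x ≢ y → δ x y ≡ 0ℚ
δ-≢ {x} {y} x≢y with x ℕ.≟ y
... | yes x≡y = contradiction x≡y x≢y
... | no _    = refl

0≤δ : ∀ x y → 0ℚ ≤ δ x y
0≤δ x y with x ℕ.≟ y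
... | yes _ = nonNegative⁻¹ _
... | no _  = ≤-refl

δ*-absent : ∀ {d} l (f : ℕ → ℚ) → All (d ≢_) l → ∑ l (λ e → δ d e * f e) ≡ 0ℚ
δ*-absent []      f []          = refl
δ*-absent (x ∷ l) f (d≢x ∷ d∉l) =
  cong₂ _+_ (trans (cong (_* f x) (δ-≢ d≢x)) (*-zeroˡ (f x))) (δ*-absent l f d∉l)

∑-δ : ∀ {d} l (f : ℕ → ℚ) → Unique l → d ∈ l → ∑ l (λ e → δ d e * f e) ≡ f d
∑-δ (x ∷ l) f (x∉l ∷ _) (here refl) =
  trans (cong₂ _+_ (trans (cong (_* f x) (δ-refl x)) (*-identityˡ (f x))) (δ*-absent l f x∉l))
        (+-identityʳ (f x))
∑-δ {d} (x ∷ l) f (x∉l ∷ l-unique) (there d∈l) =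
  trans (cong₂ _+_ (trans (cong (_* f x) (δ-≢ d≢x)) (*-zeroˡ (f x))) (∑-δ l f l-unique d∈l))
        (+-identityˡ (f d))
  where
  d≢x : d ≢ x
  d≢x d≡x = All.lookup x∉l d∈l (sym d≡x)

all-or-counterexample : {P : I → Set} → Decidable P → (l : List I) →
                        (∀ x → x ∈ l → P x) ⊎ ∃ λ x → x ∈ l × ¬ P x
all-or-counterexample P? l with all? P? l
... | yes all = inj₁ (λ x x∈l → All.lookup all x∈l)
... | no ¬all = inj₂ (find (¬All⇒Any¬ P? l ¬all))

divisors-unique : ∀ N → Unique (divisors N)
divisors-unique N = Unique.filter⁺ (_∣? N) (Unique.upTo⁺ (suc N))

module _ (N : ℕ) where

  private
    𝒟 : List ℕ
    𝒟 = divisors N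

  AX-cong : ∀ {Y Z} → (∀ d → d ∈ 𝒟 → Y d ≡ Z d) → ∀ t → AX N Y t ≡ AX N Z t
  AX-cong Y≗Z t = ∑-cong 𝒟 (λ d d∈𝒟 → cong (λ z → A N t d * ι z) (Y≗Z d d∈𝒟))

  AX-homo-+ : ∀ Y Z t → AX N (λ d → Y d ℤ.+ Z d) t ≡ AX N Y t + AX N Z t
  AX-homo-+ Y Z t = trans (∑-cong 𝒟 distrib) (∑-distrib-+ 𝒟 _ _)
    where
    distrib : ∀ d → d ∈ 𝒟 → A N t d * ι (Y d ℤ.+ Z d) ≡ A N t d * ι (Y d) + A N t d * ι (Z d)
    distrib d _ = trans (cong (A N t d *_) (ι-homo-+ (Y d) (Z d)))
                        (*-distribˡ-+ (A N t d) (ι (Y d)) (ι (Z d)))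

  AX≢0⇒NonConstant : ∀ {Y} t → AX N Y t ≢ 0ℚ → NonConstant N Y
  AX≢0⇒NonConstant {Y} t AY≢0 with all-or-counterexample (λ d → Y d ℤ.≟ + 0) 𝒟
  ... | inj₂ Y≢0 = Y≢0
  ... | inj₁ Y≡0 = contradiction AY≡0 AY≢0
    where
    AY≡0 : AX N Y t ≡ 0ℚ
    AY≡0 = trans (AX-cong {Z = λ _ → + 0} Y≡0 t) (trans (∑-cong 𝒟 (λ d _ → *-zeroʳ (A N t d))) (∑-zero 𝒟))

  normalizedOrder : (ℕ → ℤ) → (ℕ → ℕ) → ℕ → ℚ
  normalizedOrder X m t = AX N X t * reciprocal (m t)

  0≤normalizedOrder : ∀ X m → Holomorphic N X → ∀ t → t ∈ 𝒟 → 0ℚ ≤ normalizedOrder X m t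
  0≤normalizedOrder X m X-holomorphic t t∈𝒟 = 0≤p⇒0≤q⇒0≤p*q (X-holomorphic t t∈𝒟) (0≤reciprocal (m t))

  module _ {C : ℕ → ℕ → ℚ} (C-inverse : IsInverseOfA N C) where

    C*AX≡ι : ∀ X d → d ∈ 𝒟 → ∑ 𝒟 (λ t → C d t * AX N X t) ≡ ι (X d)
    C*AX≡ι X d d∈𝒟 = begin
      ∑ 𝒟 (λ t → C d t * ∑ 𝒟 (λ e → A N t e * ι (X e)))
        ≡⟨ ∑-cong 𝒟 (λ t _ → sym (∑-*ˡ 𝒟 (C d t) (λ e → A N t e * ι (X e)))) ⟩
      ∑ 𝒟 (λ t → ∑ 𝒟 (λ e → C d t * (A N t e * ι (X e))))
        ≡⟨ ∑-comm 𝒟 𝒟 (λ t e → C d t * (A N t e * ι (X e))) ⟩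
      ∑ 𝒟 (λ e → ∑ 𝒟 (λ t → C d t * (A N t e * ι (X e))))
        ≡⟨ ∑-cong 𝒟 (λ e _ → trans (∑-cong 𝒟 (λ t _ → sym (*-assoc (C d t) (A N t e) (ι (X e)))))
                                   (∑-*ʳ 𝒟 (ι (X e)) (λ t → C d t * A N t e))) ⟩
      ∑ 𝒟 (λ e → ∑ 𝒟 (λ t → C d t * A N t e) * ι (X e))
        ≡⟨ ∑-cong 𝒟 (λ e e∈𝒟 → cong (_* ι (X e)) (proj₂ C-inverse d e d∈𝒟 e∈𝒟)) ⟩
      ∑ 𝒟 (λ e → δ d e * ι (X e))
        ≡⟨ ∑-δ 𝒟 (λ e → ι (X e)) (divisors-unique N) d∈𝒟 ⟩
      ι (X d)
        ∎
      where open ≡-Reasoning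

    AX-column : ∀ {Z} c t → t ∈ 𝒟 → (∀ d → d ∈ 𝒟 → ι (Z d) ≡ c * C d t) →
                ∀ s → s ∈ 𝒟 → AX N Z s ≡ c * δ s t
    AX-column {Z} c t t∈𝒟 ιZ≡cC s s∈𝒟 = begin
      ∑ 𝒟 (λ e → A N s e * ι (Z e))    ≡⟨ ∑-cong 𝒟 (λ e e∈𝒟 → cong (A N s e *_) (ιZ≡cC e e∈𝒟)) ⟩
      ∑ 𝒟 (λ e → A N s e * (c * C e t)) ≡⟨ ∑-cong 𝒟 (λ e _ → swap (A N s e) c (C e t)) ⟩
      ∑ 𝒟 (λ e → c * (A N s e * C e t)) ≡⟨ ∑-*ˡ 𝒟 c (λ e → A N s e * C e t) ⟩
      c * ∑ 𝒟 (λ e → A N s e * C e t)   ≡⟨ cong (c *_) (proj₁ C-inverse s t s∈𝒟 t∈𝒟) ⟩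
      c * δ s t                          ∎
      where
      open ≡-Reasoning
      swap : ∀ a b c → a * (b * c) ≡ b * (a * c)
      swap = solve 3 (λ a b c → a :* (b :* c) := b :* (a :* c)) refl

    module _ {t k} (t∈𝒟 : t ∈ 𝒟) (1≤k : 1 ℕ.≤ k) (integral : IntegralColumnMultiple N C t k) where

      -- By integrality, the numerators of k·C(·,t) are the integer vector itself.
      column : ℕ → ℤ
      column d = ↥ (ι (+ k) * C d t)

      ι-column : ∀ d → d ∈ 𝒟 → ι (column d) ≡ ι (+ k) * C d t
      ι-column d d∈𝒟 = ι-↥ (integral d d∈𝒟)

      AX-column≡kδ : ∀ s → s ∈ 𝒟 → AX N column s ≡ ι (+ k) * δ s t
      AX-column≡kδ = AX-column {column} (ι (+ k)) t t∈𝒟 ι-column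

      column-holomorphic : Holomorphic N column
      column-holomorphic s s∈𝒟 =
        subst (0ℚ ≤_) (sym (AX-column≡kδ s s∈𝒟)) (0≤p⇒0≤q⇒0≤p*q (0≤ι+ k) (0≤δ s t))

      column-nonConstant : NonConstant N column
      column-nonConstant = AX≢0⇒NonConstant t (ι+≢0 k 1≤k ∘ trans (sym AX-column-at-t))
        where
        AX-column-at-t : AX N column t ≡ ι (+ k)
        AX-column-at-t = trans (AX-column≡kδ t t∈𝒟)
                               (trans (cong (ι (+ k) *_) (δ-refl t)) (*-identityʳ (ι (+ k))))

      remainder : (ℕ → ℤ) → ℕ → ℤ
      remainder X d = X d ℤ.- column d

      ≡column+remainder : ∀ X d → X d ≡ column d ℤ.+ remainder X d
      ≡column+remainder X d =
        sym (trans (sym (ℤ.+-assoc (column d) (X d) (ℤ.- column d))) (xyx⁻¹≈y (column d) (X d)))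

      AX-remainder : ∀ X s → s ∈ 𝒟 → AX N (remainder X) s ≡ AX N X s - ι (+ k) * δ s t
      AX-remainder X s s∈𝒟 = begin
        AX N W s
          ≡⟨ solve 2 (λ a b → b := (a :+ b) :- a) refl (AX N column s) (AX N W s) ⟩
        (AX N column s + AX N W s) - AX N column s
          ≡⟨ cong (_- AX N column s) (AX-homo-+ column W s) ⟨
        AX N (λ d → column d ℤ.+ W d) s - AX N column s
          ≡⟨ cong₂ _-_ (AX-cong {Z = X} (λ d _ → sym (≡column+remainder X d)) s) (AX-column≡kδ s s∈𝒟) ⟩
        AX N X s - ι (+ k) * δ s t
          ∎
        where
        open ≡-Reasoning
        W : ℕ → ℤ
        W = remainder X

      remainder-holomorphic : ∀ {X} → Holomorphic N X → ι (+ k) ≤ AX N X t →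
                              Holomorphic N (remainder X)
      remainder-holomorphic {X} X-holomorphic k≤AX s s∈𝒟 =
        subst (0ℚ ≤_) (sym (AX-remainder X s s∈𝒟)) (p≤q⇒0≤q-p kδ≤AX)
        where
        kδ≤AX : ι (+ k) * δ s t ≤ AX N X s
        kδ≤AX with s ℕ.≟ t
        ... | yes refl = subst (_≤ AX N X t) (sym (*-identityʳ (ι (+ k)))) k≤AX
        ... | no _     = subst (_≤ AX N X s) (sym (*-zeroʳ (ι (+ k)))) (X-holomorphic s s∈𝒟)

      ¬Factorizable⇒≡column : ∀ {X} → Holomorphic N X → ι (+ k) ≤ AX N X t → ¬ Factorizable N X →
                              ∀ d → d ∈ 𝒟 → ι (X d) ≡ ι (+ k) * C d t
      ¬Factorizable⇒≡column {X} X-holomorphic k≤AX X-unfactorizable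
        with all-or-counterexample (λ d → remainder X d ℤ.≟ + 0) 𝒟
      ... | inj₁ remainder≡0 = λ d d∈𝒟 →
        trans (cong ι (ℤ.i-j≡0⇒i≡j (X d) (column d) (remainder≡0 d d∈𝒟))) (ι-column d d∈𝒟)
      ... | inj₂ remainder-nonConstant = contradiction
        ( column , remainder X
        , column-holomorphic , remainder-holomorphic {X} X-holomorphic k≤AX
        , column-nonConstant , remainder-nonConstant
        , λ d _ → ≡column+remainder X d )
        X-unfactorizable

    ≡B*normalizedOrder : ∀ {m} → (∀ t → t ∈ 𝒟 → 1 ℕ.≤ m t) →
                         ∀ X d → d ∈ 𝒟 → ι (X d) ≡ Σ𝒟 N (λ t → B C m d t * normalizedOrder X m t)
    ≡B*normalizedOrder {m} 1≤m X d d∈𝒟 = trans (sym (C*AX≡ι X d d∈𝒟)) (∑-cong 𝒟 C*AX≡B*y)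
      where
      C*AX≡B*y : ∀ t → t ∈ 𝒟 → C d t * AX N X t ≡ B C m d t * normalizedOrder X m t
      C*AX≡B*y t t∈𝒟 = sym (begin
        ι (+ m t) * C d t * (AX N X t * reciprocal (m t))
          ≡⟨ solve 4 (λ a c x r → (a :* c) :* (x :* r) := (c :* x) :* (a :* r)) refl
                     (ι (+ m t)) (C d t) (AX N X t) (reciprocal (m t)) ⟩
        C d t * AX N X t * (ι (+ m t) * reciprocal (m t))
          ≡⟨ cong (C d t * AX N X t *_) (ι*reciprocal (m t) (1≤m t t∈𝒟)) ⟩
        C d t * AX N X t * 1ℚ
          ≡⟨ *-identityʳ (C d t * AX N X t) ⟩
        C d t * AX N X t
          ∎)
        where open ≡-Reasoning

lemma2 : (N : ℕ) → .{{_ : NonZero N}} → (X : ℕ → ℤ)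
         → (C : ℕ → ℕ → ℚ) → IsInverseOfA N C
         → (m : ℕ → ℕ) → (∀ t → t ∈ divisors N → IsMinimalMultiplier N C t (m t))
         → Holomorphic N X → ¬ Factorizable N X
         → (∃ λ (y : ℕ → ℚ) →
              (∀ d → d ∈ divisors N → 0ℚ ≤ y d × y d < 1ℚ) ×
              (∀ d → d ∈ divisors N → ι (X d) ≡ Σ𝒟 N (λ t → B C m d t * y t)))
           ⊎ (∃ λ t → t ∈ divisors N × (∀ d → d ∈ divisors N → ι (X d) ≡ B C m d t))
lemma2 N X C C-inverse m m-minimal X-holomorphic X-unfactorizable
  with all-or-counterexample (λ t → normalizedOrder N X m t <? 1ℚ) (divisors N)
... | inj₁ y<1 =
  inj₁ ( normalizedOrder N X m
       , (λ d d∈𝒟 → 0≤normalizedOrder N X m X-holomorphic d d∈𝒟 , y<1 d d∈𝒟)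
       , ≡B*normalizedOrder N C-inverse 1≤m X )
  where
  1≤m : ∀ t → t ∈ divisors N → 1 ℕ.≤ m t
  1≤m t t∈𝒟 = proj₁ (m-minimal t t∈𝒟)
... | inj₂ (t , t∈𝒟 , y≮1) =
  inj₂ ( t , t∈𝒟
       , ¬Factorizable⇒≡column N C-inverse t∈𝒟 1≤m integral
           X-holomorphic (*reciprocal≮1⇒ι≤ (AX N X t) (m t) 1≤m y≮1) X-unfactorizable )
  where
  1≤m : 1 ℕ.≤ m t
  1≤m = proj₁ (m-minimal t t∈𝒟)
  integral : IntegralColumnMultiple N C t (m t)
  integral = proj₁ (proj₂ (m-minimal t t∈𝒟))
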